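{- Let $G=(V,E)$ be a strongly connected directed graph, let $P=(p_1,\dots,p_\ell)$ be a cut path in $G$, and let $P'=(p_i,\dots,p_j)$ with $1\le i<j\le\ell$ be a subwalk of $P$. If $p_{j-1}$ and $p_{\ell-1}$ are splits, then $R^+(P')\subseteq R^+(P)$. If $p_2$ and $p_{i+1}$ are joins, then $R^-(P')\subseteq R^-(P)$.
   Context: A walk is a sequence of nodes with consecutive pairs being arcs; a subwalk is a contiguous subsequence. A walk $P$ is a cut path if there exist nodes $u,v$ such that every $u$-$v$ walk in $G$ has $P$ as a subwalk. A split is a node with at least two outgoing arcs; a join is a node with at least two incoming arcs. For a walk $X=(x_1,\dots,x_k)$, $k\ge2$: $R^+(X)$ is the set of nodes $v$ such that there is an $x_1$-$v$ walk in $G$ with arc $(x_{k-1},x_k)$ removed; $R^-(X)$ is the set of nodes $v$ such that there is a $v$-$x_k$ walk in $G$ with arc $(x_1,x_2)$ removed. -}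

module Defs where

open import Data.Nat using (ℕ; zero; suc)
open import Data.Fin using (Fin)
open import Data.List using (List; []; _∷_; _++_; head; last)
open import Data.Maybe using (Maybe; just; nothing)
open import Data.Product using (Σ; ∃; ∃₂; _×_; _,_)
open import Relation.Binary.PropositionalEquality using (_≡_; _≢_)
open import Relation.Nullary using (¬_)

Graph : ℕ → Set₁
Graph n = Fin n → Fin n → Set

module _ {n : ℕ} where

  V : Set
  V = Fin n

  data IsWalk (E : Graph n) : List V → Set where
    single : ∀ x → IsWalk E (x ∷ [])
    cons   : ∀ {x y xs} → E x y → IsWalk E (y ∷ xs) → IsWalk E (x ∷ y ∷ xs)

  IsUVWalk : Graph n → V → V → List V → Set
  IsUVWalk E u v W = IsWalk E W × head W ≡ just u × last W ≡ just v

  Subwalk : List V → List V → Set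
  Subwalk P W = ∃₂ λ xs ys → W ≡ xs ++ P ++ ys

  StronglyConnected : Graph n → Set
  StronglyConnected E = ∀ u v → ∃ λ W → IsUVWalk E u v W

  IsCutPath : Graph n → List V → Set
  IsCutPath E P = IsWalk E P × ∃₂ λ u v → ∀ W → IsUVWalk E u v W → Subwalk P W

  IsSplit : Graph n → V → Set
  IsSplit E v = ∃₂ λ w₁ w₂ → w₁ ≢ w₂ × E v w₁ × E v w₂

  IsJoin : Graph n → V → Set
  IsJoin E v = ∃₂ λ w₁ w₂ → w₁ ≢ w₂ × E w₁ v × E w₂ v

  -- 0-based safe indexing
  _‼_ : List V → ℕ → Maybe V
  []       ‼ _     = nothing
  (x ∷ xs) ‼ zero  = just x
  (x ∷ xs) ‼ suc k = xs ‼ k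

  IsSplitAt : Graph n → List V → ℕ → Set
  IsSplitAt E P k = ∃ λ v → P ‼ k ≡ just v × IsSplit E v

  IsJoinAt : Graph n → List V → ℕ → Set
  IsJoinAt E P k = ∃ λ v → P ‼ k ≡ just v × IsJoin E v

  Remove : Graph n → V → V → Graph n
  Remove E a b x y = E x y × ¬ (x ≡ a × y ≡ b)

  firstArc : List V → Maybe (V × V)
  firstArc (x ∷ y ∷ _) = just (x , y)
  firstArc _           = nothing

  lastArc : List V → Maybe (V × V)
  lastArc (x ∷ y ∷ []) = just (x , y)
  lastArc (x ∷ y ∷ z ∷ xs) = lastArc (y ∷ z ∷ xs)
  lastArc _ = nothing

  R⁺ : Graph n → List V → V → Set
  R⁺ E X v = Σ V λ x₁ → Σ V λ a → Σ V λ b →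
    head X ≡ just x₁ × lastArc X ≡ just (a , b) × ∃ λ W → IsUVWalk (Remove E a b) x₁ v W

  R⁻ : Graph n → List V → V → Set
  R⁻ E X v = Σ V λ xk → Σ V λ a → Σ V λ b →
    last X ≡ just xk × firstArc X ≡ just (a , b) × ∃ λ W → IsUVWalk (Remove E a b) v xk W

  _⊆_ : (V → Set) → (V → Set) → Set
  A ⊆ B = ∀ v → A v → B v

{-# OPTIONS --safe #-}
-- Fix an arc e and count how often walks traverse it. A cut path P traverses e at most
-- as often as any walk Z with the same endpoints: otherwise, replacing the occurrence of P
-- in a u–v walk by Z yields a u–v walk traversing e fewer times, which again contains P,
-- and so on forever. Now let X be a subwalk of P with last arc e and let v ∈ R⁺(X) via a
-- walk W avoiding e. Prefixing W with the part of P before X gives a walk from p₁ to v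
-- traversing e fewer times than P. It therefore cannot use the last arc of P, so
-- v ∈ R⁺(P). The inclusion for R⁻ is symmetric.
module Submission where

open import Defs
open import Data.Nat using (ℕ; suc; _+_; _<_; _≤_; _∸_; s≤s)
open import Data.Nat.Properties
  using (m≤m+n; m≤n+m; ≤-<-trans; <⇒≱; ≮⇒≥; +-monoˡ-<; +-monoʳ-<)
open import Data.Nat.Induction using (<-wellFounded)
open import Induction.WellFounded using (Acc; acc)
open import Data.Fin using (Fin)
open import Data.Fin.Properties using (_≟_)
open import Data.List using (List; []; _∷_; _++_; _∷ʳ_; length; filter; take; drop; head; last)
open import Data.List.Properties using (length-++; filter-++; filter-some; filter-none; ++-assoc; ∷ʳ-++; take++drop≡id)
open import Data.List.Relation.Unary.Any using (here; there)
open import Data.List.Relation.Unary.All using (All; []; _∷_)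
open import Data.List.Relation.Unary.All.Properties using (++⁺; ++⁻ˡ; ++⁻ʳ; ¬Any⇒All¬)
open import Data.List.Membership.Propositional using (_∈_; _∉_)
open import Data.List.Membership.Propositional.Properties using (∈-++⁺ˡ; ∈-++⁺ʳ)
open import Data.Maybe using (just)
open import Data.Product using (_×_; ∃₂; _,_; proj₁; proj₂; uncurry)
open import Data.Product.Properties using (≡-dec)
open import Function using (_∘_)
open import Relation.Binary.Definitions using (DecidableEquality)
open import Relation.Binary.PropositionalEquality using (_≡_; refl; sym; trans; cong; subst; subst₂)
open import Relation.Nullary using (yes; no; contradiction)
open import Data.Empty using (⊥)

module _ {n : ℕ} where

  Arc : Set
  Arc = Fin n × Fin n

  _≟ᵃ_ : DecidableEquality Arc
  _≟ᵃ_ = ≡-dec _≟_ _≟_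

  open import Data.List.Membership.DecPropositional _≟ᵃ_ using (_∈?_)

  private variable
    E : Graph n
    a b u v w x y : Fin n
    e : Arc
    xs ys zs P W X Y Z : List (Fin n)

  arcs : List (Fin n) → List Arc
  arcs (x ∷ y ∷ xs) = (x , y) ∷ arcs (y ∷ xs)
  arcs _            = []

  uses : Arc → List (Fin n) → ℕ
  uses e W = length (filter (e ≟ᵃ_) (arcs W))

  head-++ : head xs ≡ just x → head (xs ++ ys) ≡ just x
  head-++ {xs = _ ∷ _} hx = hx

  head-++-∷ : ∀ xs → head (xs ++ y ∷ ys) ≡ head (xs ++ y ∷ zs)
  head-++-∷ []      = refl
  head-++-∷ (_ ∷ _) = refl

  last-++ : ∀ xs → last xs ≡ just x → last (xs ++ ys) ≡ last (x ∷ ys)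
  last-++ (_ ∷ [])     refl = refl
  last-++ (_ ∷ _ ∷ xs) lx   = last-++ (_ ∷ xs) lx

  last-++-∷ : ∀ xs → last (xs ++ y ∷ ys) ≡ last (y ∷ ys)
  last-++-∷ []           = refl
  last-++-∷ (_ ∷ [])     = refl
  last-++-∷ (_ ∷ _ ∷ xs) = last-++-∷ (_ ∷ xs)

  arcs-++ˡ : ∀ xs → last xs ≡ just x → arcs (xs ++ ys) ≡ arcs xs ++ arcs (x ∷ ys)
  arcs-++ˡ (_ ∷ [])     refl = refl
  arcs-++ˡ (x ∷ y ∷ xs) lx   = cong ((x , y) ∷_) (arcs-++ˡ (y ∷ xs) lx)

  arcs-++ʳ : ∀ xs → arcs (xs ++ y ∷ ys) ≡ arcs (xs ∷ʳ y) ++ arcs (y ∷ ys)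
  arcs-++ʳ []           = refl
  arcs-++ʳ (_ ∷ [])     = refl
  arcs-++ʳ (x ∷ y ∷ xs) = cong ((x , y) ∷_) (arcs-++ʳ (y ∷ xs))

  ∈-arcs⇒split : ∀ W → (a , b) ∈ arcs W → ∃₂ λ xs ys → W ≡ xs ++ a ∷ b ∷ ys
  ∈-arcs⇒split (x ∷ y ∷ W) (here refl) = [] , W , refl
  ∈-arcs⇒split (x ∷ y ∷ W) (there ab∈)
    with xs , ys , eq ← ∈-arcs⇒split (y ∷ W) ab∈ = x ∷ xs , ys , cong (x ∷_) eq

  lastArc⇒last : ∀ W → lastArc W ≡ just (a , b) → last W ≡ just b
  lastArc⇒last (_ ∷ _ ∷ [])     refl = refl
  lastArc⇒last (_ ∷ y ∷ z ∷ W) la   = lastArc⇒last (y ∷ z ∷ W) la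

  firstArc⇒head : ∀ W → firstArc W ≡ just (a , b) → head W ≡ just a
  firstArc⇒head (_ ∷ _ ∷ _) refl = refl

  lastArc∈arcs : ∀ W → lastArc W ≡ just e → e ∈ arcs W
  lastArc∈arcs (_ ∷ _ ∷ [])     refl = here refl
  lastArc∈arcs (_ ∷ y ∷ z ∷ W) la   = there (lastArc∈arcs (y ∷ z ∷ W) la)

  firstArc∈arcs : ∀ W → firstArc W ≡ just e → e ∈ arcs W
  firstArc∈arcs (_ ∷ _ ∷ _) refl = here refl

  length-filter-++ : ∀ es fs → length (filter (e ≟ᵃ_) (es ++ fs))
                               ≡ length (filter (e ≟ᵃ_) es) + length (filter (e ≟ᵃ_) fs)
  length-filter-++ {e = e} es fs =
    trans (cong length (filter-++ (e ≟ᵃ_) es fs)) (length-++ (filter (e ≟ᵃ_) es))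

  uses-++ˡ : ∀ xs → last xs ≡ just x → uses e (xs ++ ys) ≡ uses e xs + uses e (x ∷ ys)
  uses-++ˡ {e = e} xs lx =
    trans (cong (length ∘ filter (e ≟ᵃ_)) (arcs-++ˡ xs lx)) (length-filter-++ (arcs xs) _)

  uses-++ʳ : ∀ xs → uses e (xs ++ y ∷ ys) ≡ uses e (xs ∷ʳ y) + uses e (y ∷ ys)
  uses-++ʳ {e = e} xs =
    trans (cong (length ∘ filter (e ≟ᵃ_)) (arcs-++ʳ xs)) (length-filter-++ (arcs (xs ∷ʳ _)) _)

  ∉⇒uses≡0 : e ∉ arcs W → uses e W ≡ 0
  ∉⇒uses≡0 {e = e} e∉ = cong length (filter-none (e ≟ᵃ_) (¬Any⇒All¬ _ e∉))

  ∈⇒uses>0 : e ∈ arcs W → 0 < uses e W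
  ∈⇒uses>0 {e = e} = filter-some (e ≟ᵃ_)

  walk⇒arcs : IsWalk E W → All (uncurry E) (arcs W)
  walk⇒arcs (single _) = []
  walk⇒arcs (cons e w) = e ∷ walk⇒arcs w

  arcs⇒walk : head W ≡ just x → All (uncurry E) (arcs W) → IsWalk E W
  arcs⇒walk {W = x ∷ []}    _ []       = single x
  arcs⇒walk {W = _ ∷ _ ∷ _} _ (e ∷ es) = cons e (arcs⇒walk refl es)

  avoiding⇒removeWalk : IsWalk E W → (a , b) ∉ arcs W → IsWalk (Remove E a b) W
  avoiding⇒removeWalk (single x) _   = single x
  avoiding⇒removeWalk (cons e w) ab∉ =
    cons (e , λ { (refl , refl) → ab∉ (here refl) }) (avoiding⇒removeWalk w (ab∉ ∘ there))

  removeWalk⇒walk : IsWalk (Remove E a b) W → IsWalk E W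
  removeWalk⇒walk (single x)     = single x
  removeWalk⇒walk (cons (e , _) w) = cons e (removeWalk⇒walk w)

  removeWalk⇒avoiding : IsWalk (Remove E a b) W → (a , b) ∉ arcs W
  removeWalk⇒avoiding (cons (_ , ab≢) _) (here refl) = ab≢ (refl , refl)
  removeWalk⇒avoiding (cons _ w)         (there ab∈) = removeWalk⇒avoiding w ab∈

  uvWalk-prefix : IsUVWalk E u v (xs ++ y ∷ ys) → IsUVWalk E u y (xs ∷ʳ y)
  uvWalk-prefix {xs = xs} (q , hu , _) =
    arcs⇒walk (trans (head-++-∷ xs) hu) (++⁻ˡ _ (subst (All _) (arcs-++ʳ xs) (walk⇒arcs q))) ,
    trans (head-++-∷ xs) hu , last-++-∷ xs

  uvWalk-suffix : IsUVWalk E u v (xs ++ y ∷ ys) → IsUVWalk E y v (y ∷ ys)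
  uvWalk-suffix {xs = xs} (q , _ , lv) =
    arcs⇒walk refl (++⁻ʳ (arcs (xs ∷ʳ _)) (subst (All _) (arcs-++ʳ xs) (walk⇒arcs q))) ,
    refl , trans (sym (last-++-∷ xs)) lv

  uvWalk-replace-prefix : last xs ≡ just x → IsUVWalk E u v (xs ++ ys) →
                          IsUVWalk E w x zs → IsUVWalk E w v (zs ++ ys)
  uvWalk-replace-prefix {xs = xs} {zs = zs} lx (q , _ , lv) (z , hz , lz) =
    arcs⇒walk (head-++ hz) (subst (All _) (sym (arcs-++ˡ zs lz)) (++⁺ (walk⇒arcs z) suffix)) ,
    head-++ hz , trans (last-++ zs lz) (trans (sym (last-++ xs lx)) lv)
    where suffix = ++⁻ʳ (arcs xs) (subst (All _) (arcs-++ˡ xs lx) (walk⇒arcs q))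

  uvWalk-replace-suffix : IsUVWalk E u v (xs ++ y ∷ ys) → IsUVWalk E y w (y ∷ zs) →
                          IsUVWalk E u w (xs ++ y ∷ zs)
  uvWalk-replace-suffix {xs = xs} (q , hu , _) (z , _ , lz) =
    arcs⇒walk hu′ (subst (All _) (sym (arcs-++ʳ xs)) (++⁺ prefix (walk⇒arcs z))) ,
    hu′ , trans (last-++-∷ xs) lz
    where
    hu′ = trans (head-++-∷ xs) hu
    prefix = ++⁻ˡ (arcs (xs ∷ʳ _)) (subst (All _) (arcs-++ʳ xs) (walk⇒arcs q))

  uses-prefix : ∀ xs → uses e (xs ∷ʳ y) ≤ uses e (xs ++ y ∷ ys)
  uses-prefix xs = subst (_ ≤_) (sym (uses-++ʳ xs)) (m≤m+n _ _)

  uses-suffix : ∀ xs → uses e (y ∷ ys) ≤ uses e (xs ++ y ∷ ys)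
  uses-suffix xs = subst (_ ≤_) (sym (uses-++ʳ xs)) (m≤n+m _ _)

  uses-replace-prefix< : ∀ xs zs ys → last xs ≡ just x → last zs ≡ just x →
                         uses e zs < uses e xs → uses e (zs ++ ys) < uses e (xs ++ ys)
  uses-replace-prefix< {e = e} xs zs ys lx lz fewer =
    subst₂ _<_ (sym (uses-++ˡ zs lz)) (sym (uses-++ˡ xs lx)) (+-monoˡ-< (uses e (_ ∷ ys)) fewer)

  uses-replace-suffix< : ∀ xs → uses e (y ∷ zs) < uses e (y ∷ ys) →
                         uses e (xs ++ y ∷ zs) < uses e (xs ++ y ∷ ys)
  uses-replace-suffix< {e = e} xs fewer =
    subst₂ _<_ (sym (uses-++ʳ xs)) (sym (uses-++ʳ xs)) (+-monoʳ-< (uses e (xs ∷ʳ _)) fewer)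

  uses-splice< : ∀ xs ys → head P ≡ just x → head Z ≡ just x → last P ≡ just y → last Z ≡ just y →
                 uses e Z < uses e P → uses e (xs ++ Z ++ ys) < uses e (xs ++ P ++ ys)
  uses-splice< {P = P@(_ ∷ _)} {Z = Z@(_ ∷ _)} xs ys refl refl lP lZ fewer =
    uses-replace-suffix< xs (uses-replace-prefix< P Z ys lP lZ fewer)

  uvWalk-splice : ∀ xs ys → IsUVWalk E x y P → IsUVWalk E x y Z →
                  IsUVWalk E u v (xs ++ P ++ ys) → IsUVWalk E u v (xs ++ Z ++ ys)
  uvWalk-splice {P = _ ∷ _} {Z = _ ∷ _} xs ys (_ , refl , lP) z@(_ , refl , _) q =
    uvWalk-replace-suffix q (uvWalk-replace-prefix lP (uvWalk-suffix q) z)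

  cutPath-uses-minimal : StronglyConnected E → IsCutPath E P →
                         head P ≡ just x → last P ≡ just y → IsUVWalk E x y Z → uses e P ≤ uses e Z
  cutPath-uses-minimal {E = E} {P = P} {x = x} {y = y} {Z = Z} {e = e} sc (wP , u , v , cut) hP lP z =
    ≮⇒≥ λ fewer → noWalk fewer _ (<-wellFounded _) (proj₂ (sc u v))
    where
    noWalk : uses e Z < uses e P → ∀ Q → Acc _<_ (uses e Q) → IsUVWalk E u v Q → ⊥
    noWalk fewer Q (acc rs) q with xs , ys , refl ← cut Q q =
      noWalk fewer (xs ++ Z ++ ys)
             (rs (uses-splice< xs ys hP (proj₁ (proj₂ z)) lP (proj₂ (proj₂ z)) fewer))
             (uvWalk-splice xs ys (wP , hP , lP) z q)

  -- If Y used the last arc of P, its prefix through that arc would be a walk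
  -- between the endpoints of P using e fewer times than P.
  avoid-lastArc : StronglyConnected E → IsCutPath E P → head P ≡ just x → lastArc P ≡ just (a , b) →
                  IsUVWalk E x v Y → uses e Y < uses e P → IsUVWalk (Remove E a b) x v Y
  avoid-lastArc {P = P} {a = a} {b = b} {Y = Y} sc cp hP laP y@(wY , hY , lY) fewer
    with (a , b) ∈? arcs Y
  ... | no ab∉ = avoiding⇒removeWalk wY ab∉ , hY , lY
  ... | yes ab∈ with xs , ys , eq ← ∈-arcs⇒split Y ab∈
                 with refl ← trans eq (sym (∷ʳ-++ xs a (b ∷ ys))) =
    contradiction (cutPath-uses-minimal sc cp hP (lastArc⇒last P laP) (uvWalk-prefix y))
                  (<⇒≱ (≤-<-trans (uses-prefix (xs ∷ʳ a)) fewer))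

  avoid-firstArc : StronglyConnected E → IsCutPath E P → firstArc P ≡ just (a , b) → last P ≡ just y →
                   IsUVWalk E v y Y → uses e Y < uses e P → IsUVWalk (Remove E a b) v y Y
  avoid-firstArc {P = P} {a = a} {b = b} {Y = Y} sc cp faP lP y@(wY , hY , lY) fewer
    with (a , b) ∈? arcs Y
  ... | no ab∉ = avoiding⇒removeWalk wY ab∉ , hY , lY
  ... | yes ab∈ with xs , ys , refl ← ∈-arcs⇒split Y ab∈ =
    contradiction (cutPath-uses-minimal sc cp (firstArc⇒head P faP) lP (uvWalk-suffix y))
                  (<⇒≱ (≤-<-trans (uses-suffix xs) fewer))

  R⁺-subwalk : StronglyConnected E → IsCutPath E P → head P ≡ just x → lastArc P ≡ just (a , b) →
               Subwalk X P → R⁺ E X ⊆ R⁺ E P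
  R⁺-subwalk {P = P} {x = x} {a = a} {b = b} {X = X@(_ ∷ _)} sc cp hP laP (T , R , refl) v
    (_ , a′ , b′ , refl , laX , W@(_ ∷ _) , w , refl , lW) =
    x , a , b , hP , laP , T ++ W , avoid-lastArc sc cp hP laP walk fewer
    where
    walk = uvWalk-replace-suffix (proj₁ cp , hP , lastArc⇒last P laP) (removeWalk⇒walk w , refl , lW)
    used : (a′ , b′) ∈ arcs (X ++ R)
    used = subst ((a′ , b′) ∈_) (sym (arcs-++ˡ X (lastArc⇒last X laX))) (∈-++⁺ˡ (lastArc∈arcs X laX))
    fewer : uses (a′ , b′) (T ++ W) < uses (a′ , b′) P
    fewer = uses-replace-suffix< T
              (subst (_< _) (sym (∉⇒uses≡0 (removeWalk⇒avoiding w))) (∈⇒uses>0 used))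

  R⁻-subwalk : StronglyConnected E → IsCutPath E P → last P ≡ just y → firstArc P ≡ just (a , b) →
               Subwalk X P → R⁻ E X ⊆ R⁻ E P
  R⁻-subwalk {P = P} {y = y} {a = a} {b = b} {X = X@(x ∷ _)} sc cp lP faP (T , R , eq) v
    (_ , a′ , b′ , lX , faX , W , w , hW , lW)
    with refl ← trans eq (sym (++-assoc T X R)) =
    y , a , b , lP , faP , W ++ R , avoid-firstArc sc cp faP lP walk fewer
    where
    lTX : last (T ++ X) ≡ just _
    lTX = trans (last-++-∷ T) lX
    walk = uvWalk-replace-prefix lTX (proj₁ cp , firstArc⇒head P faP , lP) (removeWalk⇒walk w , hW , lW)
    used : (a′ , b′) ∈ arcs (T ++ X)
    used = subst ((a′ , b′) ∈_) (sym (arcs-++ʳ T)) (∈-++⁺ʳ (arcs (T ∷ʳ x)) (firstArc∈arcs X faX))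
    fewer : uses (a′ , b′) (W ++ R) < uses (a′ , b′) P
    fewer = uses-replace-prefix< (T ++ X) W R lTX lW
              (subst (_< _) (sym (∉⇒uses≡0 (removeWalk⇒avoiding w))) (∈⇒uses>0 used))

  take-drop-subwalk : ∀ i m (P : List (Fin n)) → Subwalk (take m (drop i P)) P
  take-drop-subwalk i m P =
    take i P , drop m (drop i P) ,
    sym (trans (cong (take i P ++_) (take++drop≡id m (drop i P))) (take++drop≡id i P))

  lastArc-∷-∷ : ∀ (x y : Fin n) xs → ∃₂ λ a b → lastArc (x ∷ y ∷ xs) ≡ just (a , b)
  lastArc-∷-∷ x y []       = x , y , refl
  lastArc-∷-∷ x y (z ∷ xs) = lastArc-∷-∷ y z xs

theorem22 : ∀ {n} (E : Graph n) → StronglyConnected E →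
    (P : List (Fin n)) → IsCutPath E P →
    (i j : ℕ) → i < j → j < length P →
    (IsSplitAt E P (j ∸ 1) → IsSplitAt E P (length P ∸ 2) →
      R⁺ E (take (suc (j ∸ i)) (drop i P)) ⊆ R⁺ E P)
    × (IsJoinAt E P 1 → IsJoinAt E P (suc i) →
      R⁻ E (take (suc (j ∸ i)) (drop i P)) ⊆ R⁻ E P)
theorem22 E sc (p ∷ [])        cp i (suc j) _ (s≤s ())
theorem22 E sc P@(p ∷ q ∷ P′) cp i j _ _ with _ , _ , laP ← lastArc-∷-∷ p q P′ =
  (λ _ _ → R⁺-subwalk sc cp refl laP X⊑P) , (λ _ _ → R⁻-subwalk sc cp (lastArc⇒last P laP) refl X⊑P)
  where
  X⊑P : Subwalk (take (suc (j ∸ i)) (drop i P)) P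
  X⊑P = take-drop-subwalk i (suc (j ∸ i)) P
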